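{- For every integer $n\ge 4$, $fw(1\,2\ldots n\;1\;3\ldots n\;3\;2)=4$.
   Context: Sequences are written as concatenations of letters. A sequence $s$ contains $u$ if some (not necessarily contiguous) subsequence of $s$ can be changed into $u$ by a one-to-one renaming of letters. An $(r,s)$-formation is a concatenation of $s$ permutations, each of the same set of $r$ distinct letters. The formation width $fw(u)$ is the minimum $s$ such that there exists $r$ for which every $(r,s)$-formation contains $u$. -}

module Defs where

open import Data.Nat using (ℕ; zero; suc; _+_; _∸_; _<_; _≤_)
open import Data.List using (List; []; _∷_; _++_; map; concat; length; upTo)
open import Data.List.Membership.Propositional using (_∈_)
open import Data.List.Relation.Binary.Sublist.Propositional using (_⊆_)
open import Data.List.Relation.Binary.Permutation.Propositional using (_↭_)
open import Data.List.Relation.Unary.All using (All)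
open import Data.List.Relation.Unary.Unique.Propositional using (Unique)
open import Data.Product using (Σ; ∃; _×_; _,_)
open import Relation.Binary.PropositionalEquality using (_≡_)
open import Relation.Nullary using (¬_)

Seq : Set
Seq = List ℕ

_contains_ : Seq → Seq → Set
s contains u =
  Σ Seq λ t → (t ⊆ s) ×
  Σ (ℕ → ℕ) λ f → (∀ {x y} → x ∈ u → y ∈ u → f x ≡ f y → x ≡ y) × (map f u ≡ t)

IsFormation : ℕ → ℕ → Seq → Set
IsFormation r s w =
  Σ Seq λ L → Unique L × length L ≡ r ×
  Σ (List Seq) λ ps → length ps ≡ s × All (λ p → p ↭ L) ps × concat ps ≡ w

AllFormationsContain : ℕ → ℕ → Seq → Set
AllFormationsContain r s u = ∀ w → IsFormation r s w → w contains u

Works : ℕ → Seq → Set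
Works s u = ∃ λ r → AllFormationsContain r s u

FwIs : Seq → ℕ → Set
FwIs u k = Works k u × (∀ s → s < k → ¬ Works s u)

-- [a, a+1, ..., b] (empty if b < a)
range : ℕ → ℕ → Seq
range a b = map (a +_) (upTo (suc b ∸ a))

pat : ℕ → Seq
pat n = range 1 n ++ (1 ∷ []) ++ range 3 n ++ (3 ∷ 2 ∷ [])

-- Iterating the Erdős–Szekeres theorem inside four permutations of a large enough alphabet
-- gives n letters x₁ … xₙ, in the order of the first permutation, which each of the other
-- three lists either in this order or in reverse. For every combination of orientations the
-- letters can be renamed v₁ … vₙ so that v₁ v₂ v₃…vₙ v₁ v₃…vₙ v₃ v₂ splits into four
-- consecutive pieces, one inside each permutation. Conversely the pattern contains b c c c b,
-- which three copies of a word without repeated letters avoid: the three c's need three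
-- different copies, forcing b before c in the first copy and c before b in the last one.

module Submission where

open import Defs
open import Data.Nat using (ℕ; zero; suc; _+_; _<_; _≤_; z≤n; s≤s)
open import Data.Nat.Properties using (suc-injective; +-suc; _≤?_; ≰⇒>; +-mono-<; <⇒≱; ≤-reflexive; m≤n⇒∃[o]m+o≡n)
open import Data.List using (List; []; _∷_; _++_; map; concat; length; upTo; applyUpTo; reverse; replicate; initLast; _∷ʳ′_)
open import Data.List.Properties using (map-++; map-∘; map-upTo; map-applyUpTo; ++-assoc; ++-identityʳ; reverse-++; unfold-reverse; reverse-involutive; length-reverse; length-upTo; length-replicate)
open import Data.List.Membership.Propositional using (_∈_)
open import Data.List.Membership.Propositional.Properties using (∈-∃++; ∈-++⁻; ∈-map⁺)
open import Data.List.Relation.Unary.Any using (here; there)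
open import Data.List.Relation.Unary.All as All using (All; []; _∷_)
open import Data.List.Relation.Unary.All.Properties as All using (replicate⁺)
open import Data.List.Relation.Unary.AllPairs using ([]; _∷_)
open import Data.List.Relation.Unary.Unique.Propositional using (Unique)
open import Data.List.Relation.Unary.Unique.Propositional.Properties using (upTo⁺)
open import Data.List.Relation.Binary.Sublist.Propositional using (_⊆_; []; _∷_; _∷ʳ_; minimum; from∈; ⊆-refl; ⊆-trans; ⊆-reflexive)
open import Data.List.Relation.Binary.Sublist.Propositional.Properties using (++⁺; ++⁺ˡ; ++⁺ʳ; reverse⁺; map⁺; All-resp-⊆; Any-resp-⊆)
open import Data.List.Relation.Binary.Sublist.Heterogeneous.Properties using (∷ˡ⁻)
open import Data.List.Relation.Binary.Permutation.Propositional using (_↭_; prep; ↭-sym; ↭-trans; ↭⇒↭ₛ) renaming (refl to ↭-refl)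
open import Data.List.Relation.Binary.Permutation.Propositional.Properties using (All-resp-↭; ↭-length; ↭-reverse; ∷↭∷ʳ; shift)
open import Data.List.Relation.Binary.Permutation.Setoid.Properties using (Unique-resp-↭)
open import Data.Product using (∃; ∃₂; _×_; _,_)
open import Data.Sum using (_⊎_; inj₁; inj₂; map₁)
open import Data.Empty using (⊥-elim)
open import Function using (_∘_; id)
open import Relation.Nullary using (¬_; yes; no)
open import Relation.Binary.PropositionalEquality using (_≡_; _≢_; refl; sym; trans; cong; cong₂; subst; subst₂; setoid; module ≡-Reasoning)

private
  variable
    A : Set
    x y : A
    k m n : ℕ
    xs ys L q : List A
    p₁ p₂ p₃ p₄ w : Seq

Unique-⊆ : xs ⊆ ys → Unique ys → Unique xs
Unique-⊆ []            []        = []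
Unique-⊆ (_ ∷ʳ xs⊆)    (_ ∷ u)   = Unique-⊆ xs⊆ u
Unique-⊆ (refl ∷ xs⊆)  (y∉ ∷ u)  = All-resp-⊆ xs⊆ y∉ ∷ Unique-⊆ xs⊆ u

Unique-↭ : xs ↭ ys → Unique xs → Unique ys
Unique-↭ p = Unique-resp-↭ (setoid _) (↭⇒↭ₛ p)

injectiveOn-map : ∀ {B : Set} {f : A → B} → Unique (map f xs) → x ∈ xs → y ∈ xs → f x ≡ f y → x ≡ y
injectiveOn-map {xs = _ ∷ _} _          (here refl) (here refl) _  = refl
injectiveOn-map {xs = _ ∷ _} (fx∉ ∷ _)  (here refl) (there y∈)  eq = ⊥-elim (All.lookup fx∉ (∈-map⁺ _ y∈) eq)
injectiveOn-map {xs = _ ∷ _} (fy∉ ∷ _)  (there x∈)  (here refl) eq = ⊥-elim (All.lookup fy∉ (∈-map⁺ _ x∈) (sym eq))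
injectiveOn-map {xs = _ ∷ _} (_ ∷ u)    (there x∈)  (there y∈)  eq = injectiveOn-map u x∈ y∈ eq

m+n≤o+p⇒m≤o⊎n≤p : ∀ {m n o p} → m + n ≤ o + p → m ≤ o ⊎ n ≤ p
m+n≤o+p⇒m≤o⊎n≤p {m} {n} {o} {p} le with m ≤? o | n ≤? p
... | yes m≤o | _       = inj₁ m≤o
... | no _    | yes n≤p = inj₂ n≤p
... | no m≰o  | no n≰p  = ⊥-elim (<⇒≱ (+-mono-< (≰⇒> m≰o) (≰⇒> n≰p)) le)

partition-⊎ : ∀ {P Q : A → Set} → All (λ x → P x ⊎ Q x) xs →
  ∃₂ λ ys zs → ys ⊆ xs × zs ⊆ xs × All P ys × All Q zs × length ys + length zs ≡ length xs
partition-⊎ [] = [] , [] , [] , [] , [] , [] , refl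
partition-⊎ {xs = x ∷ _} (inj₁ px ∷ pqs) =
  let ys , zs , ys⊆ , zs⊆ , pys , qzs , len = partition-⊎ pqs
  in x ∷ ys , zs , refl ∷ ys⊆ , x ∷ʳ zs⊆ , px ∷ pys , qzs , cong suc len
partition-⊎ {xs = x ∷ _} (inj₂ qx ∷ pqs) =
  let ys , zs , ys⊆ , zs⊆ , pys , qzs , len = partition-⊎ pqs
  in ys , x ∷ zs , x ∷ʳ ys⊆ , refl ∷ zs⊆ , pys , qx ∷ qzs , trans (+-suc _ _) (cong suc len)

∈-either-side : ∀ q₁ {q₂} → y ∈ q₁ ++ x ∷ q₂ → x ≢ y → y ∈ q₁ ⊎ y ∈ q₂
∈-either-side q₁ y∈ x≢y with ∈-++⁻ q₁ y∈
... | inj₁ y∈q₁          = inj₁ y∈q₁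
... | inj₂ (here refl)   = ⊥-elim (x≢y refl)
... | inj₂ (there y∈q₂)  = inj₂ y∈q₂

-- Erdős–Szekeres

-- Opaque because at arguments with several literal suc's its unfolding has exponential size,
-- which the type checker would otherwise meet when comparing bounds.
opaque
  es-bound : ℕ → ℕ → ℕ
  es-bound zero    _       = 0
  es-bound (suc a) zero    = 0
  es-bound (suc a) (suc b) = suc (es-bound (suc a) b + es-bound a (suc b))

HasMonotone : ℕ → ℕ → List A → List A → Set
HasMonotone a b xs q = ∃ λ ys → ys ⊆ xs × (ys ⊆ q × length ys ≡ a ⊎ reverse ys ⊆ q × length ys ≡ b)

HasMonotone-⊆ : ∀ {a b} {q : List A} → xs ⊆ ys → HasMonotone a b xs q → HasMonotone a b ys q
HasMonotone-⊆ xs⊆ (zs , zs⊆ , mono) = zs , ⊆-trans zs⊆ xs⊆ , mono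

extend-ahead : ∀ {a b} q₁ {q₂ : List A} → HasMonotone a b xs q₂ → HasMonotone (suc a) b (x ∷ xs) (q₁ ++ x ∷ q₂)
extend-ahead q₁ (ys , ys⊆ , inj₁ (ys⊆q₂ , l)) = _ ∷ ys , refl ∷ ys⊆ , inj₁ (++⁺ˡ q₁ (refl ∷ ys⊆q₂) , cong suc l)
extend-ahead q₁ (ys , ys⊆ , inj₂ (rys⊆q₂ , l)) = ys , _ ∷ʳ ys⊆ , inj₂ (++⁺ˡ q₁ (_ ∷ʳ rys⊆q₂) , l)

extend-behind : ∀ {a b} {q₁} q₂ → HasMonotone a b xs q₁ → HasMonotone a (suc b) (x ∷ xs) (q₁ ++ x ∷ q₂)
extend-behind q₂ (ys , ys⊆ , inj₁ (ys⊆q₁ , l)) = ys , _ ∷ʳ ys⊆ , inj₁ (++⁺ʳ (_ ∷ q₂) ys⊆q₁ , l)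
extend-behind {x = x} q₂ (ys , ys⊆ , inj₂ (rys⊆q₁ , l)) =
  x ∷ ys , refl ∷ ys⊆ ,
  inj₂ (subst (_⊆ _) (sym (unfold-reverse x ys)) (++⁺ rys⊆q₁ (refl ∷ minimum q₂)) , cong suc l)

opaque
  unfolding es-bound
  erdős-szekeres : ∀ a b {xs q : List A} → Unique xs → All (_∈ q) xs → es-bound a b ≤ length xs → HasMonotone a b xs q
  erdős-szekeres zero    _       _ _ _ = [] , minimum _ , inj₁ (minimum _ , refl)
  erdős-szekeres (suc a) zero    _ _ _ = [] , minimum _ , inj₂ (minimum _ , refl)
  erdős-szekeres (suc a) (suc b) {x ∷ xs} (x∉xs ∷ u) (x∈q ∷ xs∈q) (s≤s big)
    with q₁ , q₂ , refl ← ∈-∃++ x∈q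
    with earlier , later , earlier⊆ , later⊆ , earlier∈ , later∈ , len
           ← partition-⊎ (All.zipWith (λ (y∈ , x≢y) → ∈-either-side q₁ y∈ x≢y) (xs∈q , x∉xs))
    with m+n≤o+p⇒m≤o⊎n≤p (subst (_ ≤_) (sym len) big)
  ... | inj₁ enough =
    extend-behind q₂ (HasMonotone-⊆ earlier⊆ (erdős-szekeres (suc a) b (Unique-⊆ earlier⊆ u) earlier∈ enough))
  ... | inj₂ enough =
    extend-ahead q₁ (HasMonotone-⊆ later⊆ (erdős-szekeres a (suc b) (Unique-⊆ later⊆ u) later∈ enough))

_⊆±_ : List A → List A → Set
xs ⊆± q = xs ⊆ q ⊎ reverse xs ⊆ q

⊆-⊆±-trans : xs ⊆ ys → ys ⊆± q → xs ⊆± q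
⊆-⊆±-trans xs⊆ (inj₁ ys⊆q) = inj₁ (⊆-trans xs⊆ ys⊆q)
⊆-⊆±-trans xs⊆ (inj₂ rys⊆q) = inj₂ (⊆-trans (reverse⁺ xs⊆) rys⊆q)

⊆±⇒All∈ : xs ⊆± q → All (_∈ q) xs
⊆±⇒All∈ (inj₁ xs⊆q)          = All-resp-⊆ xs⊆q (All.tabulate id)
⊆±⇒All∈ {xs = xs} (inj₂ rxs⊆q) = All-resp-↭ (↭-reverse xs) (All-resp-⊆ rxs⊆q (All.tabulate id))

monotone-subsequence : ∀ n {xs q : List A} → Unique xs → All (_∈ q) xs → es-bound n n ≤ length xs →
  ∃ λ ys → ys ⊆ xs × ys ⊆± q × length ys ≡ n
monotone-subsequence n u xs∈q big with erdős-szekeres n n u xs∈q big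
... | ys , ys⊆ , inj₁ (ys⊆q , l) = ys , ys⊆ , inj₁ ys⊆q , l
... | ys , ys⊆ , inj₂ (rys⊆q , l) = ys , ys⊆ , inj₂ rys⊆q , l

ramsey-bound : ℕ → ℕ → ℕ
ramsey-bound zero    n = n
ramsey-bound (suc k) n = es-bound (ramsey-bound k n) (ramsey-bound k n)

monotone-in-all : ∀ n qs {xs : List A} → Unique xs → All (λ q → All (_∈ q) xs) qs →
  length xs ≡ ramsey-bound (length qs) n → ∃ λ ys → ys ⊆ xs × length ys ≡ n × All (ys ⊆±_) qs
monotone-in-all n [] {xs} _ _ len = xs , ⊆-refl , len , []
monotone-in-all n (q ∷ qs) u (xs∈q ∷ xs∈qs) len
  with zs , zs⊆ , zs-mono , zs-len ← monotone-subsequence (ramsey-bound (length qs) n) u xs∈q (≤-reflexive (sym len))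
  with ys , ys⊆ , ys-len , ys-monos ← monotone-in-all n qs (Unique-⊆ zs⊆ u) (All.map (All-resp-⊆ zs⊆) xs∈qs) zs-len
  = ys , ⊆-trans ys⊆ zs⊆ , ys-len , ⊆-⊆±-trans ys⊆ zs-mono ∷ ys-monos

-- Spelling the pattern

patternOf : A → A → A → List A → List A
patternOf a b c vs = a ∷ b ∷ c ∷ vs ++ a ∷ c ∷ vs ++ c ∷ b ∷ []

map-patternOf : ∀ {B : Set} (f : A → B) a b c vs →
  map f (patternOf a b c vs) ≡ patternOf (f a) (f b) (f c) (map f vs)
map-patternOf f a b c vs = cong (λ t → f a ∷ f b ∷ f c ∷ t) (begin
  map f (vs ++ a ∷ c ∷ vs ++ c ∷ b ∷ [])             ≡⟨ map-++ f vs _ ⟩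
  map f vs ++ f a ∷ f c ∷ map f (vs ++ c ∷ b ∷ [])   ≡⟨ cong (λ t → map f vs ++ f a ∷ f c ∷ t) (map-++ f vs _) ⟩
  map f vs ++ f a ∷ f c ∷ map f vs ++ f c ∷ f b ∷ [] ∎)
  where open ≡-Reasoning

patternOf-letters : ∀ (a b c : A) vs → All (_∈ a ∷ b ∷ c ∷ vs) (patternOf a b c vs)
patternOf-letters a b c vs =
  a∈ ∷ b∈ ∷ c∈ ∷ All.++⁺ vs∈ (a∈ ∷ c∈ ∷ All.++⁺ vs∈ (c∈ ∷ b∈ ∷ []))
  where
  a∈ : a ∈ a ∷ b ∷ c ∷ vs
  a∈ = here refl
  b∈ : b ∈ a ∷ b ∷ c ∷ vs
  b∈ = there (here refl)
  c∈ : c ∈ a ∷ b ∷ c ∷ vs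
  c∈ = there (there (here refl))
  vs∈ : All (_∈ a ∷ b ∷ c ∷ vs) vs
  vs∈ = All.tabulate (there ∘ there ∘ there)

patternOf-⊇ : ∀ (a b c : A) vs → b ∷ c ∷ c ∷ c ∷ b ∷ [] ⊆ patternOf a b c vs
patternOf-⊇ a b c vs = a ∷ʳ refl ∷ refl ∷ ++⁺ˡ vs (a ∷ʳ refl ∷ ++⁺ˡ vs (refl ∷ refl ∷ []))

pat≡patternOf : ∀ k → pat (3 + k) ≡ patternOf 1 2 3 (range 4 (3 + k))
pat≡patternOf k = cong₂ (λ V V′ → 1 ∷ 2 ∷ 3 ∷ V ++ 1 ∷ 3 ∷ V′ ++ 3 ∷ 2 ∷ [])
  (trans (map-applyUpTo (3 +_) (1 +_) k) (sym (map-upTo (4 +_) k)))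
  (trans (map-applyUpTo suc (3 +_) k) (sym (map-upTo (4 +_) k)))

nth : Seq → ℕ → ℕ
nth []       _       = 0
nth (v ∷ vs) zero    = v
nth (v ∷ vs) (suc i) = nth vs i

applyUpTo-nth : ∀ vs → applyUpTo (nth vs) (length vs) ≡ vs
applyUpTo-nth []       = refl
applyUpTo-nth (v ∷ vs) = cong (v ∷_) (applyUpTo-nth vs)

map-nth-range : ∀ (a b c : ℕ) vs → map (nth (0 ∷ a ∷ b ∷ c ∷ vs)) (range 4 (3 + length vs)) ≡ vs
map-nth-range a b c vs = begin
  map (nth (0 ∷ a ∷ b ∷ c ∷ vs)) (map (4 +_) (upTo (length vs))) ≡⟨ map-∘ (upTo (length vs)) ⟨
  map (nth vs) (upTo (length vs))                                 ≡⟨ map-upTo (nth vs) (length vs) ⟩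
  applyUpTo (nth vs) (length vs)                                  ≡⟨ applyUpTo-nth vs ⟩
  vs                                                              ∎
  where open ≡-Reasoning

contains-patternOf : ∀ {a b c vs} → Unique (a ∷ b ∷ c ∷ vs) → patternOf a b c vs ⊆ w →
  w contains pat (3 + length vs)
contains-patternOf {w = w} {a} {b} {c} {vs} u sub = patternOf a b c vs , sub , f , injective , image
  where
  -- The letters of pat n are 1 … n, hence the unused entry 0.
  f : ℕ → ℕ
  f = nth (0 ∷ a ∷ b ∷ c ∷ vs)
  P : Seq
  P = pat (3 + length vs)
  letters : Seq
  letters = 1 ∷ 2 ∷ 3 ∷ range 4 (3 + length vs)

  image : map f P ≡ patternOf a b c vs
  image = begin
    map f P                                             ≡⟨ cong (map f) (pat≡patternOf (length vs)) ⟩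
    map f (patternOf 1 2 3 (range 4 (3 + length vs)))   ≡⟨ map-patternOf f 1 2 3 _ ⟩
    patternOf a b c (map f (range 4 (3 + length vs)))   ≡⟨ cong (patternOf a b c) (map-nth-range a b c vs) ⟩
    patternOf a b c vs                                  ∎
    where open ≡-Reasoning

  letter : ∀ {x} → x ∈ P → x ∈ letters
  letter {x} x∈ = All.lookup (patternOf-letters 1 2 3 _) (subst (x ∈_) (pat≡patternOf (length vs)) x∈)

  renamed-letters-unique : Unique (map f letters)
  renamed-letters-unique = subst Unique (sym (cong (λ t → a ∷ b ∷ c ∷ t) (map-nth-range a b c vs))) u

  injective : ∀ {x y} → x ∈ P → y ∈ P → f x ≡ f y → x ≡ y
  injective x∈ y∈ = injectiveOn-map renamed-letters-unique (letter x∈) (letter y∈)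

-- Four permutations suffice

data PatternIn (xs w : Seq) : Set where
  arranged : ∀ {a b c vs} → a ∷ b ∷ c ∷ vs ↭ xs → patternOf a b c vs ⊆ w → PatternIn xs w

PatternIn⇒contains : Unique xs → length xs ≡ 3 + k → PatternIn xs w → w contains pat (3 + k)
PatternIn⇒contains {k = k} {w = w} u len (arranged {vs = vs} perm sub) =
  subst (λ k → w contains pat (3 + k)) vs-length (contains-patternOf (Unique-↭ (↭-sym perm) u) sub)
  where
  vs-length : length vs ≡ k
  vs-length = suc-injective (suc-injective (suc-injective (trans (↭-length perm) len)))

reversed : PatternIn (reverse xs) w → PatternIn xs w
reversed {xs = xs} (arranged perm sub) = arranged (↭-trans perm (↭-reverse xs)) sub

data Outline : Seq → Set where
  outline : ∀ a b c W d → Outline (a ∷ b ∷ c ∷ W ++ d ∷ [])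

outline-of : ∀ (xs : Seq) → length xs ≡ 4 + m → Outline xs
outline-of (a ∷ b ∷ c ∷ d ∷ xs) _ with initLast xs
... | []       = outline a b c [] d
... | ys ∷ʳ′ y = outline a b c (d ∷ ys) y

ordered-in-second : Outline xs → xs ⊆ p₁ → xs ⊆ p₂ → All (_∈ p₃) xs → All (_∈ p₄) xs →
  PatternIn xs (p₁ ++ p₂ ++ p₃ ++ p₄)
ordered-in-second (outline a b c W d) s₁ s₂ (_ ∷ _ ∷ c∈ ∷ _) (_ ∷ b∈ ∷ _) =
  arranged ↭-refl (++⁺ s₁ (++⁺ (⊆-trans (refl ∷ b ∷ʳ ⊆-refl) s₂) (++⁺ (from∈ c∈) (from∈ b∈))))

ordered-in-third : Outline xs → xs ⊆ p₁ ++ p₂ → xs ⊆ p₃ → reverse xs ⊆ p₄ →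
  PatternIn xs (p₁ ++ p₂ ++ p₃ ++ p₄)
ordered-in-third {p₁ = p₁} {p₂ = p₂} {p₃ = p₃} {p₄ = p₄} (outline a b c W d) s₁₂ s₃ r₄ =
  arranged ↭-refl (subst₂ _⊆_ pieces (++-assoc p₁ p₂ (p₃ ++ p₄)) (++⁺ s₁₂ (++⁺ c₃ c₄)))
  where
  pieces : (a ∷ b ∷ c ∷ W ++ d ∷ []) ++ (a ∷ c ∷ W) ++ (d ∷ c ∷ b ∷ []) ≡ patternOf a b c (W ++ d ∷ [])
  pieces = cong (λ t → a ∷ b ∷ c ∷ (W ++ d ∷ []) ++ a ∷ c ∷ t) (sym (++-assoc W (d ∷ []) (c ∷ b ∷ [])))
  c₃ : a ∷ c ∷ W ⊆ p₃
  c₃ = ⊆-trans (refl ∷ b ∷ʳ refl ∷ ++⁺ʳ (d ∷ []) ⊆-refl) s₃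
  c₄ : d ∷ c ∷ b ∷ [] ⊆ p₄
  c₄ = ⊆-trans (reverse⁺ (a ∷ʳ refl ∷ refl ∷ ++⁺ˡ W (refl ∷ []))) r₄

ordered-only-in-second : Outline ys → reverse ys ⊆ p₁ → ys ⊆ p₂ → reverse ys ⊆ p₃ → reverse ys ⊆ p₄ →
  PatternIn ys (p₁ ++ p₂ ++ p₃ ++ p₄)
ordered-only-in-second {p₁ = p₁} {p₂ = p₂} {p₃ = p₃} {p₄ = p₄} (outline h g e W d) r₁ s₂ r₃ r₄ =
  arranged perm (subst (_⊆ p₁ ++ p₂ ++ p₃ ++ p₄) pieces (++⁺ c₁ (++⁺ c₂ (++⁺ c₃ c₄))))
  where
  R : Seq
  R = W ++ d ∷ []
  perm : e ∷ h ∷ g ∷ reverse R ↭ h ∷ g ∷ e ∷ R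
  perm = ↭-trans (↭-sym (shift e (h ∷ g ∷ []) (reverse R))) (prep h (prep g (prep e (↭-reverse R))))
  pieces : (e ∷ []) ++ (h ∷ g ∷ []) ++ reverse (g ∷ e ∷ R) ++ reverse (h ∷ g ∷ R) ≡ patternOf e h g (reverse R)
  pieces = cong (λ t → e ∷ h ∷ g ∷ t) (begin
    reverse (g ∷ e ∷ R) ++ reverse (h ∷ g ∷ R)
      ≡⟨ cong₂ _++_ (reverse-++ (g ∷ e ∷ []) R) (reverse-++ (h ∷ g ∷ []) R) ⟩
    (reverse R ++ e ∷ g ∷ []) ++ reverse R ++ g ∷ h ∷ []
      ≡⟨ ++-assoc (reverse R) (e ∷ g ∷ []) _ ⟩
    reverse R ++ e ∷ g ∷ reverse R ++ g ∷ h ∷ [] ∎)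
    where open ≡-Reasoning
  c₁ : e ∷ [] ⊆ p₁
  c₁ = ⊆-trans (reverse⁺ e⊆) r₁
    where e⊆ : e ∷ [] ⊆ h ∷ g ∷ e ∷ R
          e⊆ = h ∷ʳ g ∷ʳ refl ∷ minimum R
  c₂ : h ∷ g ∷ [] ⊆ p₂
  c₂ = ⊆-trans (refl ∷ refl ∷ minimum _) s₂
  c₃ : reverse (g ∷ e ∷ R) ⊆ p₃
  c₃ = ⊆-trans (reverse⁺ (h ∷ʳ ⊆-refl {x = g ∷ e ∷ R})) r₃
  c₄ : reverse (h ∷ g ∷ R) ⊆ p₄
  c₄ = ⊆-trans (reverse⁺ (refl ∷ refl ∷ e ∷ʳ ⊆-refl {x = R})) r₄

reversed-after-first : Outline xs → xs ⊆ p₁ → reverse xs ⊆ p₂ → reverse xs ⊆ p₃ → reverse xs ⊆ p₄ →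
  PatternIn xs (p₁ ++ p₂ ++ p₃ ++ p₄)
reversed-after-first {p₁ = p₁} {p₂ = p₂} {p₃ = p₃} {p₄ = p₄} (outline a b c W d) s₁ r₂ r₃ r₄ =
  arranged perm (subst (_⊆ p₁ ++ p₂ ++ p₃ ++ p₄) pieces (++⁺ c₁ (++⁺ c₂ (++⁺ c₃ c₄))))
  where
  U : Seq
  U = c ∷ W
  perm : a ∷ b ∷ d ∷ reverse U ↭ a ∷ b ∷ U ++ d ∷ []
  perm = prep a (prep b (↭-trans (prep d (↭-reverse U)) (∷↭∷ʳ d U)))
  pieces : (a ∷ b ∷ []) ++ reverse (a ∷ U ++ d ∷ []) ++ reverse (U ++ d ∷ []) ++ d ∷ b ∷ [] ≡ patternOf a b d (reverse U)
  pieces = cong (λ t → a ∷ b ∷ t) (begin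
    reverse (a ∷ U ++ d ∷ []) ++ reverse (U ++ d ∷ []) ++ d ∷ b ∷ []
      ≡⟨ cong₂ (λ s t → s ++ t ++ d ∷ b ∷ []) (reverse-++ (a ∷ U) (d ∷ [])) (reverse-++ U (d ∷ [])) ⟩
    d ∷ reverse (a ∷ U) ++ d ∷ reverse U ++ d ∷ b ∷ []
      ≡⟨ cong (λ s → d ∷ s ++ d ∷ reverse U ++ d ∷ b ∷ []) (unfold-reverse a U) ⟩
    d ∷ (reverse U ++ a ∷ []) ++ d ∷ reverse U ++ d ∷ b ∷ []
      ≡⟨ cong (d ∷_) (++-assoc (reverse U) (a ∷ []) _) ⟩
    d ∷ reverse U ++ a ∷ d ∷ reverse U ++ d ∷ b ∷ [] ∎)
    where open ≡-Reasoning
  c₁ : a ∷ b ∷ [] ⊆ p₁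
  c₁ = ⊆-trans (refl ∷ refl ∷ minimum _) s₁
  c₂ : reverse (a ∷ U ++ d ∷ []) ⊆ p₂
  c₂ = ⊆-trans (reverse⁺ (refl ∷ b ∷ʳ ⊆-refl {x = U ++ d ∷ []})) r₂
  c₃ : reverse (U ++ d ∷ []) ⊆ p₃
  c₃ = ⊆-trans (reverse⁺ (a ∷ʳ b ∷ʳ ⊆-refl {x = U ++ d ∷ []})) r₃
  c₄ : d ∷ b ∷ [] ⊆ p₄
  c₄ = ⊆-trans (reverse⁺ (a ∷ʳ refl ∷ ++⁺ˡ U (refl ∷ []))) r₄

reverse-reverse-⊆ : xs ⊆ q → reverse (reverse xs) ⊆ q
reverse-reverse-⊆ {xs = xs} = subst (_⊆ _) (sym (reverse-involutive xs))

pattern-in-monotone : Outline xs → Outline (reverse xs) →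
  xs ⊆ p₁ → xs ⊆± p₂ → xs ⊆± p₃ → xs ⊆± p₄ → PatternIn xs (p₁ ++ p₂ ++ p₃ ++ p₄)
pattern-in-monotone o _ s₁ (inj₁ s₂) m₃ m₄ = ordered-in-second o s₁ s₂ (⊆±⇒All∈ m₃) (⊆±⇒All∈ m₄)
pattern-in-monotone {p₁ = p₁} {p₂ = p₂} o _ s₁ (inj₂ r₂) (inj₁ s₃) (inj₂ r₄) =
  ordered-in-third {p₁ = p₁} {p₂ = p₂} o (++⁺ʳ p₂ s₁) s₃ r₄
pattern-in-monotone {p₁ = p₁} {p₂ = p₂} _ o′ _ (inj₂ r₂) (inj₂ r₃) (inj₁ s₄) =
  reversed (ordered-in-third {p₁ = p₁} {p₂ = p₂} o′ (++⁺ˡ p₁ r₂) r₃ (reverse-reverse-⊆ s₄))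
pattern-in-monotone _ o′ s₁ (inj₂ r₂) (inj₁ s₃) (inj₁ s₄) =
  reversed (ordered-only-in-second o′ (reverse-reverse-⊆ s₁) r₂ (reverse-reverse-⊆ s₃) (reverse-reverse-⊆ s₄))
pattern-in-monotone o _ s₁ (inj₂ r₂) (inj₂ r₃) (inj₂ r₄) = reversed-after-first o s₁ r₂ r₃ r₄

four-permutations-contain : ∀ m → Unique p₁ → length p₁ ≡ ramsey-bound 3 (4 + m) →
  All (_∈ p₂) p₁ → All (_∈ p₃) p₁ → All (_∈ p₄) p₁ → (p₁ ++ p₂ ++ p₃ ++ p₄) contains pat (4 + m)
four-permutations-contain {p₂ = p₂} {p₃} {p₄} m u len in₂ in₃ in₄
  with xs , xs⊆p₁ , xs-len , m₂ ∷ m₃ ∷ m₄ ∷ []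
         ← monotone-in-all (4 + m) (p₂ ∷ p₃ ∷ p₄ ∷ []) u (in₂ ∷ in₃ ∷ in₄ ∷ []) len
  = PatternIn⇒contains (Unique-⊆ xs⊆p₁ u) xs-len
      (pattern-in-monotone (outline-of xs xs-len) (outline-of (reverse xs) (trans (length-reverse xs) xs-len))
        xs⊆p₁ m₂ m₃ m₄)

four-suffice : ∀ m → AllFormationsContain (ramsey-bound 3 (4 + m)) 4 (pat (4 + m))
four-suffice m _ (L , uL , lL , p₁ ∷ p₂ ∷ p₃ ∷ p₄ ∷ [] , _ , p₁↭ ∷ p₂↭ ∷ p₃↭ ∷ p₄↭ ∷ [] , refl) =
  subst (_contains pat (4 + m)) (cong (λ t → p₁ ++ p₂ ++ p₃ ++ t) (sym (++-identityʳ p₄)))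
    (four-permutations-contain m (Unique-↭ (↭-sym p₁↭) uL) (trans (↭-length p₁↭) lL)
      (occur p₂↭) (occur p₃↭) (occur p₄↭))
  where
  occur : ∀ {q} → q ↭ L → All (_∈ q) p₁
  occur q↭ = All-resp-↭ (↭-trans q↭ (↭-sym p₁↭)) (All.tabulate id)
four-suffice m _ (_ , _ , _ , []                    , () , _)
four-suffice m _ (_ , _ , _ , _ ∷ []                , () , _)
four-suffice m _ (_ , _ , _ , _ ∷ _ ∷ []            , () , _)
four-suffice m _ (_ , _ , _ , _ ∷ _ ∷ _ ∷ []        , () , _)
four-suffice m _ (_ , _ , _ , _ ∷ _ ∷ _ ∷ _ ∷ _ ∷ _ , () , _)

-- Three copies do not suffice

∉-⊆-++ : All (x ≢_) L → x ∷ xs ⊆ L ++ ys → x ∷ xs ⊆ ys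
∉-⊆-++ []          sub          = sub
∉-⊆-++ (_ ∷ x∉)    (_ ∷ʳ sub)   = ∉-⊆-++ x∉ sub
∉-⊆-++ (x≢l ∷ _)   (refl ∷ _)   = ⊥-elim (x≢l refl)

skip-repeat : Unique L → x ∷ x ∷ xs ⊆ L ++ ys → x ∷ xs ⊆ ys
skip-repeat {L = []} _ sub      = ∷ˡ⁻ sub
skip-repeat (_ ∷ u)  (_ ∷ʳ sub) = skip-repeat u sub
skip-repeat (x∉ ∷ _) (refl ∷ sub) = ∉-⊆-++ x∉ sub

head-⊆-++ : x ∷ xs ⊆ L ++ ys → x ∷ [] ⊆ L ⊎ x ∷ xs ⊆ ys
head-⊆-++ {L = []}    sub        = inj₂ sub
head-⊆-++ {L = _ ∷ _} (_ ∷ʳ sub) = map₁ (_ ∷ʳ_) (head-⊆-++ sub)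
head-⊆-++ {L = _ ∷ L} (refl ∷ _) = inj₁ (refl ∷ minimum L)

pair-⊆-++ : x ∷ y ∷ xs ⊆ L ++ ys → x ∷ y ∷ [] ⊆ L ⊎ y ∷ xs ⊆ ys
pair-⊆-++ {L = []}    sub          = inj₂ (∷ˡ⁻ sub)
pair-⊆-++ {L = _ ∷ _} (_ ∷ʳ sub)   = map₁ (_ ∷ʳ_) (pair-⊆-++ sub)
pair-⊆-++ {L = _ ∷ _} (refl ∷ sub) = map₁ (refl ∷_) (head-⊆-++ sub)

both-orders : Unique L → x ∷ y ∷ [] ⊆ L → ¬ (y ∷ x ∷ [] ⊆ L)
both-orders (_ ∷ u)  (_ ∷ʳ s)   (_ ∷ʳ t)   = both-orders u s t
both-orders (l∉ ∷ _) (refl ∷ s) (refl ∷ _) = All.lookup l∉ (Any-resp-⊆ s (here refl)) refl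
both-orders (l∉ ∷ _) (refl ∷ _) (_ ∷ʳ t)   = All.lookup l∉ (Any-resp-⊆ t (there (here refl))) refl
both-orders (l∉ ∷ _) (_ ∷ʳ s)   (refl ∷ _) = All.lookup l∉ (Any-resp-⊆ s (there (here refl))) refl

three-copies-avoid : Unique L → ¬ (x ∷ y ∷ y ∷ y ∷ x ∷ [] ⊆ concat (replicate 3 L))
three-copies-avoid {L = L} {x = x} {y = y} u sub with pair-⊆-++ sub
... | inj₁ xy⊆L = both-orders u xy⊆L (⊆-trans yx⊆ (⊆-reflexive (++-identityʳ L)))
  where
  yx⊆ : y ∷ x ∷ [] ⊆ L ++ []
  yx⊆ = skip-repeat u (skip-repeat u (∷ˡ⁻ sub))
... | inj₂ yyyx with skip-repeat u (skip-repeat u yyyx)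
...   | ()

concat-replicate-⊆ : m ≤ n → concat (replicate m L) ⊆ concat (replicate n L)
concat-replicate-⊆ z≤n       = minimum _
concat-replicate-⊆ (s≤s m≤n) = ++⁺ ⊆-refl (concat-replicate-⊆ m≤n)

copies-formation : ∀ s r → IsFormation r s (concat (replicate s (upTo r)))
copies-formation s r =
  upTo r , upTo⁺ r , length-upTo r , replicate s (upTo r) , length-replicate s , replicate⁺ s ↭-refl , refl

fewer-than-four-fail : ∀ k s → s < 4 → ¬ Works s (pat (3 + k))
fewer-than-four-fail k s (s≤s s≤3) (r , works)
  with t , t⊆w , f , _ , refl ← works _ (copies-formation s r)
  = three-copies-avoid (upTo⁺ r) (⊆-trans (map⁺ f bcccb⊆pat) (⊆-trans t⊆w (concat-replicate-⊆ s≤3)))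
  where
  bcccb⊆pat : 2 ∷ 3 ∷ 3 ∷ 3 ∷ 2 ∷ [] ⊆ pat (3 + k)
  bcccb⊆pat = subst (2 ∷ 3 ∷ 3 ∷ 3 ∷ 2 ∷ [] ⊆_) (sym (pat≡patternOf k)) (patternOf-⊇ 1 2 3 _)

lemma13 : (n : ℕ) → 4 ≤ n → FwIs (pat n) 4
lemma13 n 4≤n with m , refl ← m≤n⇒∃[o]m+o≡n 4≤n =
  (ramsey-bound 3 (4 + m) , four-suffice m) , fewer-than-four-fail (suc m)
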